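{- Let $\vec x$ be a feasible assignment for an instance of the subset assignment problem. Whether $\vec x$ is a basic feasible assignment does not depend on the choice of the sets $S_p$, $p\in P_{\text{frac}}$, used in the definition of a basic feasible assignment.
   Context: An instance of the subset assignment problem consists of finitely many items, each item $p$ with a size $\operatorname{size}(p)$; bins $\mathcal B=\{b_1,\dots,b_d\}$ with capacities; and costs $\operatorname{cost}(p,S)\ge0$ for items $p$ and subsets $S\subseteq\mathcal B$. A feasible assignment is a vector $\vec x$ of reals $x(p,S)\ge0$ with $\sum_S x(p,S)=\operatorname{size}(p)$ for every item $p$ (and $\sum_{S\ni b}\sum_p x(p,S)\le\operatorname{capacity}(b)$ for each bin $b$). For $S\subseteq\mathcal B$, $\vec S\in\{0,1\}^d$ has $i$-th coordinate $1$ iff $b_i\in S$. An item $p$ is fractionally assigned if there are two distinct subsets $S\ne S'$ with $x(p,S)>0$ and $x(p,S')>0$; $P_{\text{frac}}$ is the set of fractionally assigned items. Definition (basic feasible assignment): for each $p\in P_{\text{frac}}$ select one $S_p$ with $x(p,S_p)>0$. Let $X$ be the set of pairs $(p,S)$ with $S\ne S_p$ and $0<x(p,S)<\operatorname{size}(p)$, and let $V$ be the family of vectors $\vec S-\vec S_p$, one for each $(p,S)\in X$. Then $\vec x$ is a basic feasible assignment (bfa) if and only if $V$ is linearly independent.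
   Formalization: The assignment values $x(p,S)$, item sizes, bin capacities and costs are rational, and linear independence of $V$ is tested only with rational coefficients. -}

module Defs where

open import Data.Nat using (ℕ)
open import Data.Bool using (Bool; true; false; if_then_else_)
open import Data.Fin using (Fin; zero; suc)
open import Data.Fin.Subset using (Subset; inside; outside)
open import Data.Vec using (Vec; []; _∷_; lookup)
open import Data.List using (List; []; _∷_; map; _++_; foldr)
open import Data.Rational using (ℚ; 0ℚ; 1ℚ; _+_; _*_; _-_; _≤_; _<_)
open import Data.Product using (Σ; _×_; ∃; ∃-syntax)
open import Relation.Binary.PropositionalEquality using (_≡_; _≢_)
open import Relation.Nullary using (¬_)

sumFin : (n : ℕ) → (Fin n → ℚ) → ℚ
sumFin ℕ.zero    f = 0ℚ
sumFin (ℕ.suc n) f = f zero + sumFin n (λ i → f (suc i))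

allSubsets : (d : ℕ) → List (Subset d)
allSubsets ℕ.zero    = [] ∷ []
allSubsets (ℕ.suc d) = map (inside ∷_) (allSubsets d) ++ map (outside ∷_) (allSubsets d)

sumSub : (d : ℕ) → (Subset d → ℚ) → ℚ
sumSub d f = foldr (λ S acc → f S + acc) 0ℚ (allSubsets d)

vec : {d : ℕ} → Subset d → Fin d → ℚ
vec S i = if lookup S i then 1ℚ else 0ℚ

record Instance (m d : ℕ) : Set where
  field
    size     : Fin m → ℚ
    capacity : Fin d → ℚ
    cost     : Fin m → Subset d → ℚ
    cost≥0   : ∀ p S → 0ℚ ≤ cost p S

Assignment : ℕ → ℕ → Set
Assignment m d = Fin m → Subset d → ℚ

module _ {m d : ℕ} (I : Instance m d) where
  open Instance I

  record Feasible (x : Assignment m d) : Set where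
    field
      nonneg   : ∀ p S → 0ℚ ≤ x p S
      assigned : ∀ p → sumSub d (λ S → x p S) ≡ size p
      capacityOK : ∀ b → sumSub d (λ S → vec S b * sumFin m (λ p → x p S)) ≤ capacity b

  Frac : Assignment m d → Fin m → Set
  Frac x p = ∃[ S ] ∃[ S′ ] (S ≢ S′ × 0ℚ < x p S × 0ℚ < x p S′)

  -- A choice of S_p for every fractionally assigned p with x(p,S_p) > 0
  -- (values at non-fractional items are irrelevant).
  ValidChoice : Assignment m d → (Fin m → Subset d) → Set
  ValidChoice x sel = ∀ p → Frac x p → 0ℚ < x p (sel p)

  InX : Assignment m d → (Fin m → Subset d) → Fin m → Subset d → Set
  InX x sel p S = Frac x p × S ≢ sel p × 0ℚ < x p S × x p S < size p

  -- The family V = (vec S − vec S_p)_{(p,S) ∈ X} is linearly independent: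
  -- every (finitely supported) coefficient family on X whose linear
  -- combination vanishes is identically zero.
  IsBFA : Assignment m d → (Fin m → Subset d) → Set
  IsBFA x sel =
    (c : Fin m → Subset d → ℚ) →
    (∀ p S → ¬ InX x sel p S → c p S ≡ 0ℚ) →
    (∀ i → sumFin m (λ p → sumSub d (λ S → c p S * (vec S i - vec (sel p) i))) ≡ 0ℚ) →
    ∀ p S → InX x sel p S → c p S ≡ 0ℚ

{-# OPTIONS --safe #-}
module Submission where

-- Fix an item p with chosen set B and write T for the sum of a coefficient
-- family c.  For any other set A,
--   Σ_S c S (vec S − vec B) = Σ_S c′ S (vec S − vec A),
-- where c′ = c − T·[S = B] with the entry at A dropped (it multiplies the zero
-- vector).  If p is fractional then B itself belongs to X for the choice A,
-- because 0 < x(p,B) < size(p), so c ↦ c′ sends families supported on X for B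
-- to families supported on X for A.  Conversely c′ = 0 forces c = 0 (the
-- entry at A is recovered from T = c A and c′ B = c B − T with c B = 0).
-- Hence independence for one choice implies it for any other.

open import Defs
open import Data.Nat using (ℕ; zero; suc)
open import Data.Fin using (Fin)
open import Data.Fin.Subset using (Subset; inside; outside)
open import Data.Vec using ([]; _∷_)
open import Data.Vec.Properties using (∷-injectiveʳ; ≡-dec)
open import Data.List using (List; []; _∷_; map; _++_; foldr)
open import Data.Product using (_,_)
open import Data.Rational using (ℚ; 0ℚ; _+_; _*_; _-_; _≤_; _<_)
open import Data.Rational.Properties
  using (_≟_; *-zeroˡ; +-identityˡ; +-identityʳ; +-mono-≤; +-monoʳ-<; ≤-refl; ≤-reflexive; <-≤-trans; module ≤-Reasoning)
open import Data.Rational.Solver using (module +-*-Solver)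
open import Data.Empty using (⊥-elim)
open import Function using (_∘_)
open import Function.Bundles using (_⇔_; mk⇔)
open import Relation.Binary.Definitions using (DecidableEquality)
open import Relation.Binary.PropositionalEquality using (_≡_; _≢_; refl; sym; trans; cong; cong₂; subst; module ≡-Reasoning)
open import Relation.Nullary using (¬_; yes; no)
open import Relation.Nullary.Decidable using (decidable-stable)
import Data.Bool.Properties as Bool

open +-*-Solver using (solve; _:=_; _:+_; _:*_; _:-_; con)

_≟ₛ_ : ∀ {d} → DecidableEquality (Subset d)
_≟ₛ_ = ≡-dec Bool._≟_

module _ {A : Set} where

  sumList : List A → (A → ℚ) → ℚ
  sumList L f = foldr (λ a acc → f a + acc) 0ℚ L

  sumList-cong : ∀ L {f g : A → ℚ} → (∀ a → f a ≡ g a) → sumList L f ≡ sumList L g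
  sumList-cong []      f≡g = refl
  sumList-cong (a ∷ L) f≡g = cong₂ _+_ (f≡g a) (sumList-cong L f≡g)

  sumList-zero : ∀ L {f : A → ℚ} → (∀ a → f a ≡ 0ℚ) → sumList L f ≡ 0ℚ
  sumList-zero []      f≡0 = refl
  sumList-zero (a ∷ L) f≡0 = trans (cong₂ _+_ (f≡0 a) (sumList-zero L f≡0)) (+-identityʳ 0ℚ)

  sumList-+ : ∀ L (f g : A → ℚ) → sumList L (λ a → f a + g a) ≡ sumList L f + sumList L g
  sumList-+ []      f g = refl
  sumList-+ (a ∷ L) f g = begin
    (f a + g a) + sumList L (λ a → f a + g a)     ≡⟨ cong ((f a + g a) +_) (sumList-+ L f g) ⟩
    (f a + g a) + (sumList L f + sumList L g)     ≡⟨ solve 4 (λ x y X Y → (x :+ y) :+ (X :+ Y) := (x :+ X) :+ (y :+ Y))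
                                                       refl (f a) (g a) (sumList L f) (sumList L g) ⟩
    (f a + sumList L f) + (g a + sumList L g)     ∎
    where open ≡-Reasoning

  sumList-- : ∀ L (f g : A → ℚ) → sumList L (λ a → f a - g a) ≡ sumList L f - sumList L g
  sumList-- []      f g = refl
  sumList-- (a ∷ L) f g = begin
    (f a - g a) + sumList L (λ a → f a - g a)     ≡⟨ cong ((f a - g a) +_) (sumList-- L f g) ⟩
    (f a - g a) + (sumList L f - sumList L g)     ≡⟨ solve 4 (λ x y X Y → (x :- y) :+ (X :- Y) := (x :+ X) :- (y :+ Y))
                                                       refl (f a) (g a) (sumList L f) (sumList L g) ⟩
    (f a + sumList L f) - (g a + sumList L g)     ∎
    where open ≡-Reasoning

  sumList-*ʳ : ∀ L (f : A → ℚ) k → sumList L (λ a → f a * k) ≡ sumList L f * k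
  sumList-*ʳ []      f k = sym (*-zeroˡ k)
  sumList-*ʳ (a ∷ L) f k = begin
    f a * k + sumList L (λ a → f a * k)   ≡⟨ cong (f a * k +_) (sumList-*ʳ L f k) ⟩
    f a * k + sumList L f * k             ≡⟨ solve 3 (λ x X k → x :* k :+ X :* k := (x :+ X) :* k) refl (f a) (sumList L f) k ⟩
    (f a + sumList L f) * k               ∎
    where open ≡-Reasoning

  sumList-mono-≤ : ∀ L {f g : A → ℚ} → (∀ a → f a ≤ g a) → sumList L f ≤ sumList L g
  sumList-mono-≤ []      f≤g = ≤-refl
  sumList-mono-≤ (a ∷ L) f≤g = +-mono-≤ (f≤g a) (sumList-mono-≤ L f≤g)

  sumList-++ : ∀ xs ys (f : A → ℚ) → sumList (xs ++ ys) f ≡ sumList xs f + sumList ys f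
  sumList-++ []       ys f = sym (+-identityˡ (sumList ys f))
  sumList-++ (a ∷ xs) ys f = begin
    f a + sumList (xs ++ ys) f            ≡⟨ cong (f a +_) (sumList-++ xs ys f) ⟩
    f a + (sumList xs f + sumList ys f)   ≡⟨ solve 3 (λ x X Y → x :+ (X :+ Y) := (x :+ X) :+ Y) refl (f a) (sumList xs f) (sumList ys f) ⟩
    (f a + sumList xs f) + sumList ys f   ∎
    where open ≡-Reasoning

sumList-map : ∀ {A B : Set} (h : A → B) xs (f : B → ℚ) → sumList (map h xs) f ≡ sumList xs (f ∘ h)
sumList-map h []       f = refl
sumList-map h (a ∷ xs) f = cong (f (h a) +_) (sumList-map h xs f)

sumSub-suc : ∀ {d} (f : Subset (suc d) → ℚ) →
             sumSub (suc d) f ≡ sumSub d (λ S → f (inside ∷ S)) + sumSub d (λ S → f (outside ∷ S))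
sumSub-suc {d} f = begin
  sumList (map (inside ∷_) (allSubsets d) ++ map (outside ∷_) (allSubsets d)) f
    ≡⟨ sumList-++ (map (inside ∷_) (allSubsets d)) (map (outside ∷_) (allSubsets d)) f ⟩
  sumList (map (inside ∷_) (allSubsets d)) f + sumList (map (outside ∷_) (allSubsets d)) f
    ≡⟨ cong₂ _+_ (sumList-map (inside ∷_) (allSubsets d) f) (sumList-map (outside ∷_) (allSubsets d) f) ⟩
  sumSub d (λ S → f (inside ∷ S)) + sumSub d (λ S → f (outside ∷ S)) ∎
  where open ≡-Reasoning

sumSub-concentrated : ∀ {d} (f : Subset d → ℚ) B → (∀ S → S ≢ B → f S ≡ 0ℚ) → sumSub d f ≡ f B
sumSub-concentrated {zero}  f []           _   = +-identityʳ (f [])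
sumSub-concentrated {suc d} f (inside ∷ B) off = begin
  sumSub (suc d) f                                                      ≡⟨ sumSub-suc f ⟩
  sumSub d (λ S → f (inside ∷ S)) + sumSub d (λ S → f (outside ∷ S))   ≡⟨ cong₂ _+_
    (sumSub-concentrated _ B (λ S S≢B → off _ (S≢B ∘ ∷-injectiveʳ)))
    (sumList-zero (allSubsets d) (λ S → off _ (λ ()))) ⟩
  f (inside ∷ B) + 0ℚ                                                   ≡⟨ +-identityʳ _ ⟩
  f (inside ∷ B)                                                        ∎
  where open ≡-Reasoning
sumSub-concentrated {suc d} f (outside ∷ B) off = begin
  sumSub (suc d) f                                                      ≡⟨ sumSub-suc f ⟩
  sumSub d (λ S → f (inside ∷ S)) + sumSub d (λ S → f (outside ∷ S))   ≡⟨ cong₂ _+_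
    (sumList-zero (allSubsets d) (λ S → off _ (λ ())))
    (sumSub-concentrated _ B (λ S S≢B → off _ (S≢B ∘ ∷-injectiveʳ))) ⟩
  0ℚ + f (outside ∷ B)                                                  ≡⟨ +-identityˡ _ ⟩
  f (outside ∷ B)                                                       ∎
  where open ≡-Reasoning

pointMass : ∀ {d} → Subset d → ℚ → Subset d → ℚ
pointMass B a S with S ≟ₛ B
... | yes _ = a
... | no  _ = 0ℚ

sumSub-pointMass : ∀ {d} (B : Subset d) a → sumSub d (pointMass B a) ≡ a
sumSub-pointMass {d} B a = trans (sumSub-concentrated (pointMass B a) B off) at-B
  where
  off : ∀ S → S ≢ B → pointMass B a S ≡ 0ℚ
  off S S≢B with S ≟ₛ B
  ... | yes S≡B = ⊥-elim (S≢B S≡B)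
  ... | no  _   = refl
  at-B : pointMass B a B ≡ a
  at-B with B ≟ₛ B
  ... | yes _   = refl
  ... | no  B≢B = ⊥-elim (B≢B refl)

pair≤sumSub : ∀ {d} {f : Subset d → ℚ} {B C} → (∀ S → 0ℚ ≤ f S) → B ≢ C → f B + f C ≤ sumSub d f
pair≤sumSub {d} {f} {B} {C} f≥0 B≢C = begin
  f B + f C                                                  ≡⟨ sym (cong₂ _+_ (sumSub-pointMass B (f B)) (sumSub-pointMass C (f C))) ⟩
  sumSub d (pointMass B (f B)) + sumSub d (pointMass C (f C)) ≡⟨ sym (sumList-+ (allSubsets d) (pointMass B (f B)) (pointMass C (f C))) ⟩
  sumSub d (λ S → pointMass B (f B) S + pointMass C (f C) S) ≤⟨ sumList-mono-≤ (allSubsets d) below ⟩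
  sumSub d f                                                 ∎
  where
  open ≤-Reasoning
  below : ∀ S → pointMass B (f B) S + pointMass C (f C) S ≤ f S
  below S with S ≟ₛ B | S ≟ₛ C
  ... | yes refl | yes refl = ⊥-elim (B≢C refl)
  ... | yes refl | no  _    = ≤-reflexive (+-identityʳ (f S))
  ... | no  _    | yes refl = ≤-reflexive (+-identityˡ (f S))
  ... | no  _    | no  _    = f≥0 S

point<sumSub : ∀ {d} {f : Subset d → ℚ} {B C} → (∀ S → 0ℚ ≤ f S) → B ≢ C → 0ℚ < f C → f B < sumSub d f
point<sumSub {f = f} {B} f≥0 B≢C 0<fC =
  <-≤-trans (subst (_< f B + _) (+-identityʳ (f B)) (+-monoʳ-< (f B) 0<fC)) (pair≤sumSub f≥0 B≢C)

rebase : ∀ {d} → Subset d → Subset d → (Subset d → ℚ) → Subset d → ℚ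
rebase {d} A B c S with S ≟ₛ A | S ≟ₛ B
... | yes _ | _     = 0ℚ
... | no  _ | yes _ = c S - sumSub d c
... | no  _ | no  _ = c S

module _ {d : ℕ} {A B : Subset d} {c : Subset d → ℚ} where

  rebase-at-B : B ≢ A → rebase A B c B ≡ c B - sumSub d c
  rebase-at-B B≢A with B ≟ₛ A | B ≟ₛ B
  ... | yes B≡A | _       = ⊥-elim (B≢A B≡A)
  ... | no  _   | yes _   = refl
  ... | no  _   | no  B≢B = ⊥-elim (B≢B refl)

  rebase-off : ∀ {S} → S ≢ A → S ≢ B → rebase A B c S ≡ c S
  rebase-off {S} S≢A S≢B with S ≟ₛ A | S ≟ₛ B
  ... | yes S≡A | _       = ⊥-elim (S≢A S≡A)
  ... | no  _   | yes S≡B = ⊥-elim (S≢B S≡B)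
  ... | no  _   | no  _   = refl

  rebase-combination : (v : Subset d → ℚ) →
    sumSub d (λ S → rebase A B c S * (v S - v A)) ≡ sumSub d (λ S → c S * (v S - v B))
  rebase-combination v = begin
    sumSub d (λ S → rebase A B c S * (v S - v A))
      ≡⟨ sumList-cong (allSubsets d) pointwise ⟩
    sumSub d (λ S → c S * (v S - v B) + (c S - pointMass B T S) * k)
      ≡⟨ sumList-+ (allSubsets d) (λ S → c S * (v S - v B)) (λ S → (c S - pointMass B T S) * k) ⟩
    Σc + sumSub d (λ S → (c S - pointMass B T S) * k)
      ≡⟨ cong (Σc +_) (sumList-*ʳ (allSubsets d) (λ S → c S - pointMass B T S) k) ⟩
    Σc + sumSub d (λ S → c S - pointMass B T S) * k
      ≡⟨ cong (λ t → Σc + t * k) (sumList-- (allSubsets d) c (pointMass B T)) ⟩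
    Σc + (T - sumSub d (pointMass B T)) * k
      ≡⟨ cong (λ t → Σc + (T - t) * k) (sumSub-pointMass B T) ⟩
    Σc + (T - T) * k
      ≡⟨ solve 3 (λ s t k → s :+ (t :- t) :* k := s) refl Σc T k ⟩
    Σc ∎
    where
    open ≡-Reasoning
    T  = sumSub d c
    k  = v B - v A
    Σc = sumSub d (λ S → c S * (v S - v B))
    pointwise : ∀ S → rebase A B c S * (v S - v A) ≡ c S * (v S - v B) + (c S - pointMass B T S) * k
    pointwise S with S ≟ₛ A | S ≟ₛ B
    ... | yes refl | yes refl = solve 3 (λ c v T → con 0ℚ :* (v :- v) := c :* (v :- v) :+ (c :- T) :* (v :- v))
                                  refl (c S) (v S) T
    ... | yes refl | no  _    = solve 3 (λ c a b → con 0ℚ :* (a :- a) := c :* (a :- b) :+ (c :- con 0ℚ) :* (b :- a))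
                                  refl (c S) (v S) (v B)
    ... | no  _    | yes refl = solve 4 (λ c a b T → (c :- T) :* (b :- a) := c :* (b :- b) :+ (c :- T) :* (b :- a))
                                  refl (c S) (v A) (v S) T
    ... | no  _    | no  _    = solve 4 (λ c s a b → c :* (s :- a) := c :* (s :- b) :+ (c :- con 0ℚ) :* (b :- a))
                                  refl (c S) (v S) (v A) (v B)

  rebase-vanishes : c B ≡ 0ℚ → (∀ S → rebase A B c S ≡ 0ℚ) → ∀ S → c S ≡ 0ℚ
  rebase-vanishes cB≡0 rebase≡0 = vanishes
    where
    off-A : ∀ S → S ≢ A → c S ≡ 0ℚ
    off-A S S≢A with S ≟ₛ B
    ... | yes refl = cB≡0
    ... | no  S≢B  = trans (sym (rebase-off S≢A S≢B)) (rebase≡0 S)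
    at-A : c A ≡ 0ℚ
    at-A with A ≟ₛ B
    ... | yes refl = cB≡0
    ... | no  A≢B  = begin
      c A                       ≡⟨ sym (sumSub-concentrated c A off-A) ⟩
      sumSub d c                ≡⟨ solve 2 (λ b t → t := b :- (b :- t)) refl (c B) (sumSub d c) ⟩
      c B - (c B - sumSub d c)  ≡⟨ cong₂ _-_ cB≡0 (trans (sym (rebase-at-B (A≢B ∘ sym))) (rebase≡0 B)) ⟩
      0ℚ - 0ℚ                   ≡⟨⟩
      0ℚ                        ∎
      where open ≡-Reasoning
    vanishes : ∀ S → c S ≡ 0ℚ
    vanishes S with S ≟ₛ A
    ... | yes refl = at-A
    ... | no  S≢A  = off-A S S≢A

sumFin-cong : ∀ m {f g : Fin m → ℚ} → (∀ i → f i ≡ g i) → sumFin m f ≡ sumFin m g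
sumFin-cong zero    f≡g = refl
sumFin-cong (suc m) f≡g = cong₂ _+_ (f≡g Fin.zero) (sumFin-cong m (f≡g ∘ Fin.suc))

module _ {m d : ℕ} (I : Instance m d) (x : Assignment m d) (feasible : Feasible I x) where
  open Instance I
  open Feasible feasible

  Frac⇒<size : ∀ {p} → Frac I x p → ∀ B → x p B < size p
  Frac⇒<size {p} (S , S′ , S≢S′ , 0<xS , 0<xS′) B = subst (x p B <_) (assigned p) (below B)
    where
    below : ∀ B → x p B < sumSub d (x p)
    below B with B ≟ₛ S
    ... | yes refl = point<sumSub (nonneg p) S≢S′ 0<xS′
    ... | no  B≢S  = point<sumSub (nonneg p) B≢S 0<xS

  IsBFA-transfer : ∀ {selA selB} → ValidChoice I x selB → IsBFA I x selA → IsBFA I x selB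
  IsBFA-transfer {selA} {selB} validB bfaA c c-supp c-comb p S _ =
    rebase-vanishes (c-supp p (selB p) (λ (_ , B≢B , _) → B≢B refl)) (c′-vanishes p) S
    where
    c′ : Fin m → Subset d → ℚ
    c′ p = rebase (selA p) (selB p) (c p)

    c′-supp : ∀ p S → ¬ InX I x selA p S → c′ p S ≡ 0ℚ
    c′-supp p S ¬inX with S ≟ₛ selA p | S ≟ₛ selB p
    ... | yes _   | _        = refl
    ... | no  S≢A | no  _    = c-supp p S (λ (fr , _ , pos , <size) → ¬inX (fr , S≢A , pos , <size))
    ... | no  S≢A | yes refl = cong₂ _-_ (c≡0 S) (sumList-zero (allSubsets d) c≡0)
      where
      c≡0 : ∀ S′ → c p S′ ≡ 0ℚ
      c≡0 S′ = c-supp p S′ (λ (fr , _) → ¬inX (fr , S≢A , validB p fr , Frac⇒<size fr S))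

    c′-comb : ∀ i → sumFin m (λ p → sumSub d (λ S → c′ p S * (vec S i - vec (selA p) i))) ≡ 0ℚ
    c′-comb i = trans (sumFin-cong m (λ p → rebase-combination (λ S → vec S i))) (c-comb i)

    -- InX need not be decidable, but equality of rationals is.
    c′-vanishes : ∀ p S → c′ p S ≡ 0ℚ
    c′-vanishes p S = decidable-stable (c′ p S ≟ 0ℚ) λ c′≢0 →
      c′≢0 (c′-supp p S (λ inX → c′≢0 (bfaA c′ c′-supp c′-comb p S inX)))

lemma2 : {m d : ℕ} (I : Instance m d) (x : Assignment m d) →
         Feasible I x →
         (sel₁ sel₂ : Fin m → Subset d) →
         ValidChoice I x sel₁ → ValidChoice I x sel₂ →
         IsBFA I x sel₁ ⇔ IsBFA I x sel₂
lemma2 I x feasible sel₁ sel₂ valid₁ valid₂ =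
  mk⇔ (IsBFA-transfer I x feasible valid₂) (IsBFA-transfer I x feasible valid₁)
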